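{- There do not exist a deterministic algorithm $\mathcal{A}$ for Learn-Median, a function $\alpha:\mathbb{N}\to\mathbb{R}_{\ge0}$ with $\alpha(k)/k\to0$ as $k\to\infty$, a function $g:\mathbb{N}\to\mathbb{R}_{\ge0}$ with $g(T)/T\to0$ as $T\to\infty$, and a function $f$ of $(k,n,\Delta)$, such that for every $k$, every finite metric space $(V,d)$ (with $n=|V|$ and aspect ratio $\Delta$), every $T$, every sequence $V_0,\dots,V_T$ of instances, and every $Y\subseteq V$ with $|Y|=k$, \[ \sum_{t=1}^T\rho(Y_t,V_t)\le\alpha(k)\sum_{t=1}^T\rho(Y,V_t)+g(T)\,f(k,n,\Delta), \] where $Y_t$ is the output of $\mathcal{A}$ at time $t$. This impossibility holds even if $\mathcal{A}$ knows the metric space $(V,d)$ upfront and may output any $k$ points of $V$ at each time.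
   Context: Learn-Median: $(V,d)$ is a finite metric space with $n$ points scaled so that $\min_{x\neq y}d(x,y)=1$, and $\Delta=\max_{x,y}d(x,y)$. A sequence of instances $V_0,\dots,V_T\subseteq V$, each with at least $k+1$ distinct points, arrives online; at each time $t\ge1$, knowing $V_0,\dots,V_{t-1}$ but not $V_t$, the algorithm outputs a set $Y_t$ of $k$ points (in the standard model $Y_t\subseteq V_0\cup\dots\cup V_{t-1}$). For a set $Y$, $D(Y,x)=\min_{y\in Y}d(x,y)$, $\mathrm{Cost}_t(Y)=\sum_{x\in V_t}D(Y,x)$, $\mathrm{OPT}_t=\min_{Y\subseteq V,|Y|=k}\mathrm{Cost}_t(Y)$, $\rho(Y,V_t)=\mathrm{Cost}_t(Y)/\mathrm{OPT}_t$.
   Formalization: The distances $d(x,y)$ and the functions α, g and f take values in the rationals rather than the reals. -}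

module Defs where

open import Data.Nat as ℕ using (ℕ; zero; suc)
open import Data.Bool using (Bool; true; false; if_then_else_)
open import Data.Fin using (Fin)
open import Data.Fin.Subset using (Subset; ∣_∣)
open import Data.Vec using (Vec; []; _∷_; lookup)
open import Data.List using (List; []; _∷_; map; foldr; upTo; allFin; concatMap)
open import Data.Rational as ℚ using (ℚ; 0ℚ; 1ℚ; _+_; _*_; _⊓_; _⊔_; _≤_; _<_; _÷_; ≢-nonZero)
open import Data.Integer using (+_)
open import Data.Rational.Properties using (_≟_)
open import Relation.Binary.PropositionalEquality using (_≡_; _≢_)
open import Relation.Nullary using (yes; no; ¬_)
open import Data.Product using (Σ; ∃; _×_)

-- A finite metric space on the point set Fin n with rational distances,
-- scaled so that the minimum nonzero distance is exactly 1.
record Metric (n : ℕ) : Set where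
  field
    d        : Fin n → Fin n → ℚ
    d-refl   : ∀ x → d x x ≡ 0ℚ
    d-sym    : ∀ x y → d x y ≡ d y x
    d-tri    : ∀ x y z → d x z ≤ d x y + d y z
    d-sep    : ∀ x y → x ≢ y → 1ℚ ≤ d x y
    d-minOne : Σ (Fin n) λ x → Σ (Fin n) λ y → (x ≢ y) × (d x y ≡ 1ℚ)
open Metric public

members : ∀ {n} → Subset n → List (Fin n)
members {n} S = go (allFin n)
  where
  go : List (Fin n) → List (Fin n)
  go [] = []
  go (x ∷ xs) = if lookup S x then x ∷ go xs else go xs

-- minimum / maximum of a list of rationals (only used on nonempty lists;
-- the empty case returns 0)
minimumℚ : List ℚ → ℚ
minimumℚ [] = 0ℚ
minimumℚ (q ∷ qs) = foldr _⊓_ q qs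

maximumℚ : List ℚ → ℚ
maximumℚ [] = 0ℚ
maximumℚ (q ∷ qs) = foldr _⊔_ q qs

sumℚ : List ℚ → ℚ
sumℚ = foldr _+_ 0ℚ

allSubsets : ∀ n → List (Subset n)
allSubsets zero = [] ∷ []
allSubsets (suc n) = concatMap (λ S → (true ∷ S) ∷ (false ∷ S) ∷ []) (allSubsets n)

subsetsOfSize : ∀ n → ℕ → List (Subset n)
subsetsOfSize n k = go (allSubsets n)
  where
  go : List (Subset n) → List (Subset n)
  go [] = []
  go (S ∷ Ss) with ∣ S ∣ ℕ.≟ k
  ... | yes _ = S ∷ go Ss
  ... | no  _ = go Ss

module _ {n : ℕ} (M : Metric n) where
  aspect : ℚ
  aspect = maximumℚ (concatMap (λ x → map (d M x) (allFin n)) (allFin n))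

  Dist : Subset n → Fin n → ℚ
  Dist Y x = minimumℚ (map (d M x) (members Y))

  Cost : Subset n → Subset n → ℚ
  Cost Y V = sumℚ (map (Dist Y) (members V))

  OPT : ℕ → Subset n → ℚ
  OPT k V = minimumℚ (map (λ Y → Cost Y V) (subsetsOfSize n k))

  -- ρ(Y, V) = Cost(Y) / OPT  (OPT > 0 whenever |V| ≥ k+1; 0 returned otherwise)
  ratio : ℕ → Subset n → Subset n → ℚ
  ratio k Y V with OPT k V ≟ 0ℚ
  ... | yes _ = 0ℚ
  ... | no o≢0 = _÷_ (Cost Y V) (OPT k V) {{≢-nonZero o≢0}}

-- A deterministic online algorithm for Learn-Median that knows the metric
-- space upfront and may output any k points of V: given the metric, k and the
-- history V_0, …, V_{t-1}, it outputs a set of exactly k points.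
record Algorithm : Set where
  field
    run   : ∀ {n} → Metric n → (k : ℕ) → List (Subset n) → Subset n
    valid : ∀ {n} (M : Metric n) (k : ℕ) (hist : List (Subset n)) →
            k ℕ.≤ n → ∣ run M k hist ∣ ≡ k
open Algorithm public

-- Y_t = output at time t, given V_0, …, V_{t-1}
output : Algorithm → ∀ {n} → Metric n → ℕ → (ℕ → Subset n) → ℕ → Subset n
output A M k V t = run A M k (map V (upTo t))

sumFrom1 : ℕ → (ℕ → ℚ) → ℚ
sumFrom1 T h = sumℚ (map (λ t → h (suc t)) (upTo T))

-- h(m)/m → 0 as m → ∞ (stated without division, for m ≥ N ≥ 1)
Sublinear : (ℕ → ℚ) → Set
Sublinear h = ∀ (ε : ℚ) → 0ℚ < ε →
  Σ ℕ λ N → ∀ m → N ℕ.≤ m → h m ≤ ε * ((+ m) ℚ./ 1)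

{-# OPTIONS --safe #-}
module Submission where

-- Take K = k + 1 clusters of K points each, at distance 1 within a cluster and K across
-- clusters. A set of k centres leaves some cluster empty, and the adversary always presents
-- such a cluster: its optimum is 1 (k centres cover all but one of its K points), while the
-- algorithm pays K per point, i.e. ratio K² in every round. The expert that puts one centre
-- into every cluster except cluster j has ratio at most K in rounds that do not present
-- cluster j, and at most K² otherwise, so some expert has total ratio at most 2KT over T
-- rounds. Hence K²T ≤ α(k)·2KT + g(T)·f, which fails once α(k) ≤ k/2 and g(T)·f ≤ T.

open import Defs

-- A separate module, so that the rational order used throughout does not clash with the
-- natural-number `_≤_` in the statement of theorem5.
module LowerBound where

  open import Data.Bool as Bool using (Bool; true; false; if_then_else_)
  open import Data.Bool.Properties using (T-≡; ¬-not)
  open import Data.Empty using (⊥-elim)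
  open import Data.Fin as Fin using (Fin; combine; quotient; remainder)
  import Data.Fin.Properties as Fin
  open import Data.Fin.Subset as Subset using (Subset; ∣_∣; inside; outside)
  open import Data.Fin.Subset.Properties using (∣⊥∣≡0; ∣⊤∣≡n; ∣⁅x⁆∣≡1)
  import Data.Integer as ℤ
  import Data.Integer.Properties as ℤ
  open import Data.List as List using (List; []; _∷_; map; length; foldr; upTo; _∷ʳ_; filterᵇ; tabulate; allFin; concatMap)
  import Data.List.Properties as List
  open import Data.List.Membership.Propositional using (_∈_)
  open import Data.List.Membership.Propositional.Properties using (∈-filter⁺; ∈-filter⁻; ∈-allFin)
  open import Data.List.Relation.Unary.All as All using ()
  open import Data.List.Relation.Unary.AllPairs using (_∷_)
  open import Data.List.Relation.Unary.Any using (here; there; index)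
  open import Data.List.Relation.Unary.Any.Properties using (lookup-index)
  open import Data.List.Relation.Unary.Unique.Propositional using (Unique)
  import Data.List.Relation.Unary.Unique.Propositional.Properties as Unique
  open import Data.Nat as ℕ using (ℕ; zero; suc)
  import Data.Nat.Coprimality as Coprimality
  import Data.Nat.Properties as ℕ
  open import Algebra.Properties.CommutativeSemigroup ℕ.+-commutativeSemigroup using (x∙yz≈y∙xz)
  open import Data.Product using (∃; _,_; proj₁; proj₂; map₂)
  open import Data.Rational as ℚ using (ℚ; mkℚ; 0ℚ; 1ℚ; ½; _+_; _*_; _÷_; _≤_; _<_; _⊓_; _⊔_; 1/_)
  open import Data.Rational.Properties
  open import Data.Rational.Solver using (module +-*-Solver)
  open import Data.Sum using (inj₁; inj₂)
  open import Data.Vec as Vec using (lookup; replicate; concat; _[_]≔_)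
  import Data.Vec.Properties as Vec
  open import Function using (_∘_)
  open import Function.Bundles using (Equivalence)
  open import Function.Definitions using (Injective)
  open import Level using (0ℓ)
  open import Relation.Binary.Definitions using (DecidableEquality)
  open import Relation.Binary.PropositionalEquality
  open import Relation.Nullary using (Dec; yes; no; ¬_)
  open import Relation.Nullary.Decidable using (T?)
  open import Relation.Unary using (Pred; Decidable)

  open +-*-Solver

  ι : ℕ → ℚ
  ι m = ℤ.+ m ℚ./ 1

  ι≡mkℚ : ∀ m → ι m ≡ mkℚ (ℤ.+ m) 0 (Coprimality.sym (Coprimality.1-coprimeTo m))
  ι≡mkℚ m = normalize-coprime (Coprimality.sym (Coprimality.1-coprimeTo m))

  ι-suc : ∀ m → ι (suc m) ≡ 1ℚ + ι m
  ι-suc m rewrite ι≡mkℚ m = cong (ℚ._/ 1) (cong (ℤ._+_ (ℤ.+ 1)) (sym (ℤ.*-identityʳ (ℤ.+ m))))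

  ι-suc-* : ∀ m c → ι (suc m) * c ≡ c + ι m * c
  ι-suc-* m c rewrite ι-suc m = solve 2 (λ a x → (con 1ℚ :+ a) :* x := x :+ a :* x) refl (ι m) c

  0≤ι : ∀ m → 0ℚ ≤ ι m
  0≤ι m rewrite ι≡mkℚ m = nonNegative⁻¹ _

  0<ι-suc : ∀ m → 0ℚ < ι (suc m)
  0<ι-suc m rewrite ι≡mkℚ (suc m) = positive⁻¹ _

  0≤1 : 0ℚ ≤ 1ℚ
  0≤1 = nonNegative⁻¹ 1ℚ

  p≤q⇒p≤q+r : ∀ {p q} r → p ≤ q → 0ℚ ≤ r → p ≤ q + r
  p≤q⇒p≤q+r {p} {q} r p≤q 0≤r = ≤-trans p≤q (≤-trans (≤-reflexive (sym (+-identityʳ q))) (+-monoʳ-≤ q 0≤r))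

  p≤q⇒p≤r+q : ∀ {p q} r → p ≤ q → 0ℚ ≤ r → p ≤ r + q
  p≤q⇒p≤r+q {p} {q} r p≤q 0≤r = subst (p ≤_) (+-comm q r) (p≤q⇒p≤q+r r p≤q 0≤r)

  *-nonneg : ∀ {p q} → 0ℚ ≤ p → 0ℚ ≤ q → 0ℚ ≤ p * q
  *-nonneg {p} {q} 0≤p 0≤q = ≤-trans (≤-reflexive (sym (*-zeroʳ p))) (*-monoˡ-≤-nonNeg p {{ℚ.nonNegative 0≤p}} 0≤q)

  sublinear-≤-half : ∀ {h} → Sublinear h → ∃ λ N → h (suc N) ≤ ½ * ι (suc N)
  sublinear-≤-half h-sublinear =
    let N , h≤ = h-sublinear ½ (positive⁻¹ ½) in N , h≤ (suc N) (ℕ.n≤1+n N)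

  sublinear-absorbs : ∀ {h} → (∀ m → 0ℚ ≤ h m) → Sublinear h → ∀ F → ∃ λ m → h (suc m) * F ≤ ι (suc m)
  sublinear-absorbs {h} 0≤h h-sublinear F =
    let N , h≤ε·id = h-sublinear ε (positive⁻¹ ε {{1/pos⇒pos P}}) in N , (begin
      h (suc N) * F             ≤⟨ *-monoˡ-≤-nonNeg (h (suc N)) {{ℚ.nonNegative (0≤h (suc N))}} (p≤q⊔p 1ℚ F) ⟩
      h (suc N) * P             ≤⟨ *-monoʳ-≤-nonNeg P {{ℚ.nonNegative (<⇒≤ 0<P)}} (h≤ε·id (suc N) (ℕ.n≤1+n N)) ⟩
      ε * ι (suc N) * P         ≡⟨ solve 3 (λ e t p → e :* t :* p := t :* (e :* p)) refl ε (ι (suc N)) P ⟩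
      ι (suc N) * (ε * P)       ≡⟨ cong (ι (suc N) *_) (*-inverseˡ P {{pos⇒nonZero P}}) ⟩
      ι (suc N) * 1ℚ            ≡⟨ *-identityʳ (ι (suc N)) ⟩
      ι (suc N)                 ∎)
    where
    open ≤-Reasoning
    P = 1ℚ ⊔ F
    0<P : 0ℚ < P
    0<P = <-≤-trans (positive⁻¹ 1ℚ) (p≤p⊔q 1ℚ F)
    instance
      P-positive : ℚ.Positive P
      P-positive = ℚ.positive 0<P
    ε = (1/ P) {{pos⇒nonZero P}}

  regret-gap : ∀ {a S G τ κ l} → κ ≡ 1ℚ + l → 0ℚ < τ → 0ℚ < l → 0ℚ ≤ a → a ≤ ½ * l →
               S ≤ τ * (κ + κ) → G ≤ τ → a * S + G < τ * (κ * κ)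
  regret-gap {a} {S} {G} {τ} {κ} {l} refl 0<τ 0<l 0≤a a≤l/2 S≤2τκ G≤τ = begin-strict
    a * S + G                  ≤⟨ +-mono-≤ (≤-trans (*-monoˡ-≤-nonNeg a {{ℚ.nonNegative 0≤a}} S≤2τκ)
                                                    (*-monoʳ-≤-nonNeg (τ * (κ + κ)) {{ℚ.nonNegative 0≤2τκ}} a≤l/2)) G≤τ ⟩
    ½ * l * (τ * (κ + κ)) + τ  ≡⟨ solve 2 (λ τ l → con ½ :* l :* (τ :* ((con 1ℚ :+ l) :+ (con 1ℚ :+ l))) :+ τ
                                                  := (τ :* l :* (con 1ℚ :+ l) :+ τ) :+ con 0ℚ) refl τ l ⟩
    (τ * l * κ + τ) + 0ℚ       <⟨ +-monoʳ-< (τ * l * κ + τ) 0<τl ⟩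
    (τ * l * κ + τ) + τ * l    ≡⟨ solve 2 (λ τ l → (τ :* l :* (con 1ℚ :+ l) :+ τ) :+ τ :* l
                                                  := τ :* ((con 1ℚ :+ l) :* (con 1ℚ :+ l))) refl τ l ⟩
    τ * (κ * κ)                ∎
    where
    open ≤-Reasoning
    0≤κ : 0ℚ ≤ κ
    0≤κ = p≤q⇒p≤q+r l 0≤1 (<⇒≤ 0<l)
    0≤2τκ : 0ℚ ≤ τ * (κ + κ)
    0≤2τκ = *-nonneg (<⇒≤ 0<τ) (p≤q⇒p≤q+r κ 0≤κ 0≤κ)
    0<τl : 0ℚ < τ * l
    0<τl = positive⁻¹ (τ * l) {{pos*pos⇒pos τ {{ℚ.positive 0<τ}} l {{ℚ.positive 0<l}}}}

  module _ {A : Set} (h : A → ℚ) where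
    open ≤-Reasoning

    sumℚ-map-≤ : ∀ {c} xs → (∀ {x} → x ∈ xs → h x ≤ c) → sumℚ (map h xs) ≤ ι (length xs) * c
    sumℚ-map-≤ {c} [] _ = ≤-reflexive (sym (*-zeroˡ c))
    sumℚ-map-≤ {c} (x ∷ xs) h≤c = begin
      h x + sumℚ (map h xs)    ≤⟨ +-mono-≤ (h≤c (here refl)) (sumℚ-map-≤ xs (h≤c ∘ there)) ⟩
      c + ι (length xs) * c    ≡⟨ ι-suc-* (length xs) c ⟨
      ι (length (x ∷ xs)) * c  ∎

    ≤-sumℚ-map : ∀ {c} xs → (∀ {x} → x ∈ xs → c ≤ h x) → ι (length xs) * c ≤ sumℚ (map h xs)
    ≤-sumℚ-map {c} [] _ = ≤-reflexive (*-zeroˡ c)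
    ≤-sumℚ-map {c} (x ∷ xs) c≤h = begin
      ι (length (x ∷ xs)) * c  ≡⟨ ι-suc-* (length xs) c ⟩
      c + ι (length xs) * c    ≤⟨ +-mono-≤ (c≤h (here refl)) (≤-sumℚ-map xs (c≤h ∘ there)) ⟩
      h x + sumℚ (map h xs)    ∎

    ∈⇒≤sumℚ-map : ∀ {y} xs → (∀ {x} → x ∈ xs → 0ℚ ≤ h x) → y ∈ xs → h y ≤ sumℚ (map h xs)
    ∈⇒≤sumℚ-map (x ∷ xs) 0≤h (here refl) = begin
      h x                        ≡⟨ +-identityʳ (h x) ⟨
      h x + 0ℚ                   ≡⟨ cong (h x +_) (*-zeroʳ (ι (length xs))) ⟨
      h x + ι (length xs) * 0ℚ   ≤⟨ +-monoʳ-≤ (h x) (≤-sumℚ-map xs (0≤h ∘ there)) ⟩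
      h x + sumℚ (map h xs)      ∎
    ∈⇒≤sumℚ-map {y} (x ∷ xs) 0≤h (there y∈xs) = begin
      h y                        ≡⟨ +-identityˡ (h y) ⟨
      0ℚ + h y                   ≤⟨ +-mono-≤ (0≤h (here refl)) (∈⇒≤sumℚ-map xs (0≤h ∘ there) y∈xs) ⟩
      h x + sumℚ (map h xs)      ∎

    sumℚ-map-≤-spike : DecidableEquality A → ∀ {a b} x₀ xs → Unique xs → 0ℚ ≤ a → 0ℚ ≤ b → h x₀ ≤ a →
                       (∀ {x} → x ∈ xs → x ≢ x₀ → h x ≤ b) → sumℚ (map h xs) ≤ a + ι (length xs) * b
    sumℚ-map-≤-spike _≟_ {a} {b} x₀ [] _ 0≤a _ _ _ = begin
      0ℚ                           ≤⟨ 0≤a ⟩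
      a                            ≡⟨ +-identityʳ a ⟨
      a + 0ℚ                       ≡⟨ cong (a +_) (*-zeroˡ b) ⟨
      a + ι 0 * b                  ∎
    sumℚ-map-≤-spike _≟_ {a} {b} x₀ (x ∷ xs) (x∉xs ∷ xs!) 0≤a 0≤b hx₀≤a h≤b with x ≟ x₀
    ... | yes refl = begin
      h x + sumℚ (map h xs)        ≤⟨ +-mono-≤ hx₀≤a (sumℚ-map-≤ xs (λ y∈xs → h≤b (there y∈xs) (All.lookup x∉xs y∈xs ∘ sym))) ⟩
      a + ι (length xs) * b        ≡⟨ cong (a +_) (+-identityˡ _) ⟨
      a + (0ℚ + ι (length xs) * b) ≤⟨ +-monoʳ-≤ a (+-monoˡ-≤ (ι (length xs) * b) 0≤b) ⟩
      a + (b + ι (length xs) * b)  ≡⟨ cong (a +_) (ι-suc-* (length xs) b) ⟨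
      a + ι (length (x ∷ xs)) * b  ∎
    ... | no x≢x₀ = begin
      h x + sumℚ (map h xs)        ≤⟨ +-mono-≤ (h≤b (here refl) x≢x₀) (sumℚ-map-≤-spike _≟_ x₀ xs xs! 0≤a 0≤b hx₀≤a (h≤b ∘ there)) ⟩
      b + (a + ι (length xs) * b)  ≡⟨ solve 3 (λ a b l → b :+ (a :+ l :* b) := a :+ (b :+ l :* b)) refl a b (ι (length xs)) ⟩
      a + (b + ι (length xs) * b)  ≡⟨ cong (a +_) (ι-suc-* (length xs) b) ⟨
      a + ι (length (x ∷ xs)) * b  ∎

    ∃-length*≤sumℚ-map : ∀ x xs → ∃ λ y → ι (length (x ∷ xs)) * h y ≤ sumℚ (map h (x ∷ xs))
    ∃-length*≤sumℚ-map x [] = x , ≤-reflexive (trans (*-identityˡ (h x)) (sym (+-identityʳ (h x))))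
    ∃-length*≤sumℚ-map x (x′ ∷ xs) with ∃-length*≤sumℚ-map x′ xs
    ... | y , avg-y with ≤-total (h x) (h y)
    ...   | inj₁ hx≤hy = x , (begin
      ι (suc m) * h x      ≡⟨ ι-suc-* m (h x) ⟩
      h x + ι m * h x      ≤⟨ +-monoʳ-≤ (h x) (*-monoˡ-≤-nonNeg (ι m) {{ℚ.nonNegative (0≤ι m)}} hx≤hy) ⟩
      h x + ι m * h y      ≤⟨ +-monoʳ-≤ (h x) avg-y ⟩
      h x + sumℚ (map h (x′ ∷ xs)) ∎)
      where m = length (x′ ∷ xs)
    ...   | inj₂ hy≤hx = y , (begin
      ι (suc m) * h y      ≡⟨ ι-suc-* m (h y) ⟩
      h y + ι m * h y      ≤⟨ +-mono-≤ hy≤hx avg-y ⟩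
      h x + sumℚ (map h (x′ ∷ xs)) ∎)
      where m = length (x′ ∷ xs)

    minimumℚ-map-≤ : ∀ {y} ys → y ∈ ys → minimumℚ (map h ys) ≤ h y
    minimumℚ-map-≤ (z ∷ zs) = foldr-⊓-≤ z zs
      where
      foldr-⊓-≤ : ∀ {y} z zs → y ∈ z ∷ zs → foldr _⊓_ (h z) (map h zs) ≤ h y
      foldr-⊓-≤ z []        (here refl)          = ≤-refl
      foldr-⊓-≤ z (z′ ∷ zs) (here refl)          = ≤-trans (p⊓q≤q (h z′) _) (foldr-⊓-≤ z zs (here refl))
      foldr-⊓-≤ z (z′ ∷ zs) (there (here refl))  = p⊓q≤p (h z′) _
      foldr-⊓-≤ z (z′ ∷ zs) (there (there y∈zs)) = ≤-trans (p⊓q≤q (h z′) _) (foldr-⊓-≤ z zs (there y∈zs))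

    ≤-minimumℚ-map : ∀ {c y} ys → y ∈ ys → (∀ {z} → z ∈ ys → c ≤ h z) → c ≤ minimumℚ (map h ys)
    ≤-minimumℚ-map (z ∷ zs) _ = ≤-foldr-⊓ z zs
      where
      ≤-foldr-⊓ : ∀ {c} z zs → (∀ {y} → y ∈ z ∷ zs → c ≤ h y) → c ≤ foldr _⊓_ (h z) (map h zs)
      ≤-foldr-⊓ z []        c≤h = c≤h (here refl)
      ≤-foldr-⊓ z (z′ ∷ zs) c≤h = ⊓-glb (c≤h (there (here refl)))
        (≤-foldr-⊓ z zs λ { (here refl) → c≤h (here refl) ; (there y∈zs) → c≤h (there (there y∈zs)) })

  sumℚ-map-0 : ∀ {A : Set} (xs : List A) → sumℚ (map (λ _ → 0ℚ) xs) ≡ 0ℚ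
  sumℚ-map-0 []       = refl
  sumℚ-map-0 (x ∷ xs) = trans (+-identityˡ _) (sumℚ-map-0 xs)

  sumℚ-map-+ : ∀ {A : Set} (f g : A → ℚ) xs → sumℚ (map (λ x → f x + g x) xs) ≡ sumℚ (map f xs) + sumℚ (map g xs)
  sumℚ-map-+ f g []       = refl
  sumℚ-map-+ f g (x ∷ xs) = begin
    (f x + g x) + sumℚ (map (λ x → f x + g x) xs)     ≡⟨ cong ((f x + g x) +_) (sumℚ-map-+ f g xs) ⟩
    (f x + g x) + (sumℚ (map f xs) + sumℚ (map g xs)) ≡⟨ solve 4 (λ a b c d → (a :+ b) :+ (c :+ d) := (a :+ c) :+ (b :+ d))
                                                               refl (f x) (g x) (sumℚ (map f xs)) (sumℚ (map g xs)) ⟩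
    (f x + sumℚ (map f xs)) + (g x + sumℚ (map g xs)) ∎
    where open ≡-Reasoning

  sumℚ-map-comm : ∀ {A B : Set} (r : A → B → ℚ) xs ys →
    sumℚ (map (λ x → sumℚ (map (r x) ys)) xs) ≡ sumℚ (map (λ y → sumℚ (map (λ x → r x y) xs)) ys)
  sumℚ-map-comm r []       ys = sym (sumℚ-map-0 ys)
  sumℚ-map-comm r (x ∷ xs) ys = trans (cong (sumℚ (map (r x) ys) +_) (sumℚ-map-comm r xs ys))
                                      (sym (sumℚ-map-+ (r x) (λ y → sumℚ (map (λ x → r x y) xs)) ys))

  filterᵇ-unique : ∀ {A : Set} (p : A → Bool) {g : List A → List A} → g [] ≡ [] →
                   (∀ x xs → g (x ∷ xs) ≡ (if p x then x ∷ g xs else g xs)) → ∀ xs → g xs ≡ filterᵇ p xs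
  filterᵇ-unique p g-[] g-∷ []       = g-[]
  filterᵇ-unique p g-[] g-∷ (x ∷ xs) with p x | g-∷ x xs
  ... | true  | eq = trans eq (cong (x ∷_) (filterᵇ-unique p g-[] g-∷ xs))
  ... | false | eq = trans eq (filterᵇ-unique p g-[] g-∷ xs)

  module _ {A : Set} {P : Pred A 0ℓ} (P? : Decidable P)
           {g : List A → List A} {step : (x : A) → List A → Dec (P x) → List A}
           (g-[] : g [] ≡ [])
           (g-∷ : ∀ x xs → g (x ∷ xs) ≡ step x xs (P? x))
           (step-yes : ∀ x xs p → step x xs (yes p) ≡ x ∷ g xs)
           (step-no : ∀ x xs ¬p → step x xs (no ¬p) ≡ g xs) where

    ∈-filterLike⁻ : ∀ {y} xs → y ∈ g xs → P y
    ∈-filterLike-step⁻ : ∀ {y} x xs d → y ∈ step x xs d → P y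
    ∈-filterLike⁻ [] y∈ with subst (_ ∈_) g-[] y∈
    ... | ()
    ∈-filterLike⁻ (x ∷ xs) y∈ = ∈-filterLike-step⁻ x xs (P? x) (subst (_ ∈_) (g-∷ x xs) y∈)
    ∈-filterLike-step⁻ x xs (yes p) y∈ with subst (_ ∈_) (step-yes x xs p) y∈
    ... | here refl = p
    ... | there y∈g = ∈-filterLike⁻ xs y∈g
    ∈-filterLike-step⁻ x xs (no ¬p) y∈ = ∈-filterLike⁻ xs (subst (_ ∈_) (step-no x xs ¬p) y∈)

    ∈-filterLike⁺ : ∀ {y} xs → y ∈ xs → P y → y ∈ g xs
    ∈-filterLike-step⁺ : ∀ {y} x xs d → y ∈ x ∷ xs → P y → y ∈ step x xs d
    ∈-filterLike⁺ (x ∷ xs) y∈ Py = subst (_ ∈_) (sym (g-∷ x xs)) (∈-filterLike-step⁺ x xs (P? x) y∈ Py)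
    ∈-filterLike-step⁺ x xs (yes p) (here refl) _  = subst (_ ∈_) (sym (step-yes x xs p)) (here refl)
    ∈-filterLike-step⁺ x xs (yes p) (there y∈)  Py = subst (_ ∈_) (sym (step-yes x xs p)) (there (∈-filterLike⁺ xs y∈ Py))
    ∈-filterLike-step⁺ x xs (no ¬p) (here refl) Py = ⊥-elim (¬p Py)
    ∈-filterLike-step⁺ x xs (no ¬p) (there y∈)  Py = subst (_ ∈_) (sym (step-no x xs ¬p)) (∈-filterLike⁺ xs y∈ Py)

  -- `members` and `subsetsOfSize` recurse through local functions that cannot be named.
  -- Abstracting over the list they are applied to lets unification identify the local
  -- function with `g` (and, once the decision `∣ S ∣ ≟ k` is abstracted too, its
  -- `with`-function with `step`); all the equations then hold by `refl`.
  module _ {n : ℕ} (S : Subset n) where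

    members≡filterᵇ : members S ≡ filterᵇ (lookup S) (allFin n)
    members≡filterᵇ with allFin n | filterᵇ-unique (lookup S) refl (λ _ _ → refl)
    ... | xs | g≡filterᵇ = g≡filterᵇ xs

    ∈-members⁺ : ∀ {x} → lookup S x ≡ true → x ∈ members S
    ∈-members⁺ {x} x∈S = subst (x ∈_) (sym members≡filterᵇ)
      (∈-filter⁺ (T? ∘ lookup S) (∈-allFin x) (Equivalence.from T-≡ x∈S))

    ∈-members⁻ : ∀ {x} → x ∈ members S → lookup S x ≡ true
    ∈-members⁻ {x} x∈ = Equivalence.to T-≡
      (proj₂ (∈-filter⁻ (T? ∘ lookup S) {xs = allFin n} (subst (x ∈_) members≡filterᵇ x∈)))

    members-unique : Unique (members S)
    members-unique = subst Unique (sym members≡filterᵇ) (Unique.filter⁺ (T? ∘ lookup S) (Unique.allFin⁺ n))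

  module _ {n k : ℕ} where

    ∈-subsetsOfSize⁻ : ∀ {Z} → Z ∈ subsetsOfSize n k → ∣ Z ∣ ≡ k
    ∈-subsetsOfSize⁻ with allSubsets n
                        | ∈-filterLike-step⁻ (λ S → ∣ S ∣ ℕ.≟ k) refl (λ _ _ → refl) (λ _ _ _ → refl) (λ _ _ _ → refl)
    ... | []     | _ = λ ()
    ... | S ∷ Ss | ∈-step⁻ with ∣ S ∣ ℕ.≟ k
    ...   | d = ∈-step⁻ S Ss d

    ∈-subsetsOfSize⁺ : ∀ {Z} → Z ∈ allSubsets n → ∣ Z ∣ ≡ k → Z ∈ subsetsOfSize n k
    ∈-subsetsOfSize⁺ with allSubsets n
                        | ∈-filterLike-step⁺ (λ S → ∣ S ∣ ℕ.≟ k) refl (λ _ _ → refl) (λ _ _ _ → refl) (λ _ _ _ → refl)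
    ... | []     | _ = λ ()
    ... | S ∷ Ss | ∈-step⁺ with ∣ S ∣ ℕ.≟ k
    ...   | d = ∈-step⁺ S Ss d

  ∈-allSubsets : ∀ {n} (S : Subset n) → S ∈ allSubsets n
  ∈-allSubsets {zero}  Vec.[]        = here refl
  ∈-allSubsets {suc n} (b Vec.∷ S) = ∈-extend b (allSubsets n) (∈-allSubsets S)
    where
    ∈-extend : ∀ {S : Subset n} b Ss → S ∈ Ss →
               (b Vec.∷ S) ∈ concatMap (λ S → (true Vec.∷ S) ∷ (false Vec.∷ S) ∷ []) Ss
    ∈-extend true  (_ ∷ _)  (here refl)  = here refl
    ∈-extend false (_ ∷ _)  (here refl)  = there (here refl)
    ∈-extend b     (_ ∷ Ss) (there S∈Ss) = there (there (∈-extend b Ss S∈Ss))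

  length-filterᵇ-tabulate : ∀ {A : Set} {n} (p : A → Bool) (f : Fin n → A) →
                            length (filterᵇ p (tabulate f)) ≡ ∣ Vec.tabulate (p ∘ f) ∣
  length-filterᵇ-tabulate {n = zero}  p f = refl
  length-filterᵇ-tabulate {n = suc n} p f with p (f Fin.zero)
  ... | true  = cong suc (length-filterᵇ-tabulate p (f ∘ Fin.suc))
  ... | false = length-filterᵇ-tabulate p (f ∘ Fin.suc)

  length-members : ∀ {n} (S : Subset n) → length (members S) ≡ ∣ S ∣
  length-members S = begin
    length (members S)                      ≡⟨ cong length (members≡filterᵇ S) ⟩
    length (filterᵇ (lookup S) (allFin _))  ≡⟨ length-filterᵇ-tabulate (lookup S) (λ x → x) ⟩
    ∣ Vec.tabulate (lookup S) ∣             ≡⟨ cong ∣_∣ (Vec.tabulate∘lookup S) ⟩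
    ∣ S ∣                                   ∎
    where open ≡-Reasoning

  nonempty : ∀ {n m} (Y : Subset n) → ∣ Y ∣ ≡ suc m → ∃ λ y → lookup Y y ≡ true
  nonempty Y ∣Y∣≡1+m with members Y | length-members Y | ∈-members⁻ Y
  ... | []    | 0≡∣Y∣ | _         = ⊥-elim (ℕ.0≢1+n (trans 0≡∣Y∣ ∣Y∣≡1+m))
  ... | y ∷ _ | _     | ∈Y⇒∈Y = y , ∈Y⇒∈Y (here refl)

  true≢false : true ≢ false
  true≢false ()

  misses-injective-image : ∀ {m n} (Y : Subset n) → ∣ Y ∣ ℕ.< m → (f : Fin m → Fin n) → Injective _≡_ _≡_ f →
                           ∃ λ c → lookup Y (f c) ≡ false
  misses-injective-image {m} Y ∣Y∣<m f f-injective with Fin.all? (λ c → lookup Y (f c) Bool.≟ true)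
  ... | no ¬all = map₂ ¬-not (Fin.¬∀⟶∃¬ m _ (λ c → lookup Y (f c) Bool.≟ true) ¬all)
  ... | yes all =
    let i , j , i<j , same-position = Fin.pigeonhole (subst (ℕ._< m) (sym (length-members Y)) ∣Y∣<m) (index ∘ f∈Y)
    in ⊥-elim (Fin.<⇒≢ i<j (f-injective (begin
      f i                         ≡⟨ lookup-index (f∈Y i) ⟩
      List.lookup (members Y) _   ≡⟨ cong (List.lookup (members Y)) same-position ⟩
      List.lookup (members Y) _   ≡⟨ lookup-index (f∈Y j) ⟨
      f j                         ∎)))
    where
    open ≡-Reasoning
    f∈Y : ∀ c → f c ∈ members Y
    f∈Y c = ∈-members⁺ Y (all c)

  module _ {m l : ℕ} (Y : Subset (m ℕ.* l)) where

    misses-point-of-every-block : ∣ Y ∣ ℕ.< l → ∀ c → ∃ λ r → lookup Y (combine c r) ≡ false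
    misses-point-of-every-block ∣Y∣<l c = misses-injective-image Y ∣Y∣<l (combine c) (Fin.combine-injectiveʳ {m} c _ c _)

    misses-some-block : ∣ Y ∣ ℕ.< m → ∃ λ c → ∀ r → lookup Y (combine c r) ≡ false
    misses-some-block ∣Y∣<m with Fin.any? (λ c → Fin.all? (λ r → lookup Y (combine c r) Bool.≟ false))
    ... | yes found = found
    ... | no ¬found =
      let c , f[c]∉Y = misses-injective-image Y ∣Y∣<m f (λ {c} {c′} → Fin.combine-injectiveˡ c _ c′ _)
      in ⊥-elim (true≢false (trans (sym (proj₂ (hit c))) f[c]∉Y))
      where
      hit : ∀ c → ∃ λ r → lookup Y (combine c r) ≡ true
      hit c = map₂ ¬-not (Fin.¬∀⟶∃¬ l _ (λ r → lookup Y (combine c r) Bool.≟ false) (λ empty → ¬found (c , empty)))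
      f : Fin m → Fin (m ℕ.* l)
      f c = combine c (proj₁ (hit c))

  -- Subsets of Fin (m * l) given block by block

  ∣++∣ : ∀ {m l} (p : Subset m) (q : Subset l) → ∣ p Vec.++ q ∣ ≡ ∣ p ∣ ℕ.+ ∣ q ∣
  ∣++∣ Vec.[]          q = refl
  ∣++∣ (true Vec.∷ p)  q = cong suc (∣++∣ p q)
  ∣++∣ (false Vec.∷ p) q = ∣++∣ p q

  module _ {l : ℕ} where

    blockAt : ∀ {m} → Fin m → Subset l → Subset l → Subset (m ℕ.* l)
    blockAt {m} i a b = concat (replicate m b [ i ]≔ a)

    ∣concat-replicate∣ : ∀ m (b : Subset l) → ∣ concat (replicate m b) ∣ ≡ m ℕ.* ∣ b ∣
    ∣concat-replicate∣ zero    b = refl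
    ∣concat-replicate∣ (suc m) b = trans (∣++∣ b _) (cong (∣ b ∣ ℕ.+_) (∣concat-replicate∣ m b))

    ∣blockAt∣ : ∀ {m} (i : Fin (suc m)) (a b : Subset l) → ∣ blockAt i a b ∣ ≡ ∣ a ∣ ℕ.+ m ℕ.* ∣ b ∣
    ∣blockAt∣ {m}     Fin.zero    a b = trans (∣++∣ a _) (cong (∣ a ∣ ℕ.+_) (∣concat-replicate∣ m b))
    ∣blockAt∣ {suc m} (Fin.suc i) a b = begin
      ∣ b Vec.++ blockAt i a b ∣         ≡⟨ ∣++∣ b (blockAt i a b) ⟩
      ∣ b ∣ ℕ.+ ∣ blockAt i a b ∣        ≡⟨ cong (∣ b ∣ ℕ.+_) (∣blockAt∣ i a b) ⟩
      ∣ b ∣ ℕ.+ (∣ a ∣ ℕ.+ m ℕ.* ∣ b ∣)  ≡⟨ x∙yz≈y∙xz ∣ b ∣ ∣ a ∣ _ ⟩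
      ∣ a ∣ ℕ.+ (∣ b ∣ ℕ.+ m ℕ.* ∣ b ∣)  ∎
      where open ≡-Reasoning

    ∣blockAt-⊥∣ : ∀ {m} (i : Fin (suc m)) (a : Subset l) → ∣ blockAt i a Subset.⊥ ∣ ≡ ∣ a ∣
    ∣blockAt-⊥∣ {m} i a = begin
      ∣ blockAt i a Subset.⊥ ∣            ≡⟨ ∣blockAt∣ i a Subset.⊥ ⟩
      ∣ a ∣ ℕ.+ m ℕ.* ∣ Subset.⊥ {l} ∣    ≡⟨ cong (λ z → ∣ a ∣ ℕ.+ m ℕ.* z) (∣⊥∣≡0 l) ⟩
      ∣ a ∣ ℕ.+ m ℕ.* 0                   ≡⟨ cong (∣ a ∣ ℕ.+_) (ℕ.*-zeroʳ m) ⟩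
      ∣ a ∣ ℕ.+ 0                         ≡⟨ ℕ.+-identityʳ ∣ a ∣ ⟩
      ∣ a ∣                               ∎
      where open ≡-Reasoning

    lookup-blockAt-same : ∀ {m} (i : Fin m) a b r → lookup (blockAt i a b) (combine i r) ≡ lookup a r
    lookup-blockAt-same {m} i a b r = trans (Vec.lookup-concat (replicate m b [ i ]≔ a) i r)
      (cong (λ v → lookup v r) (Vec.lookup∘update i (replicate m b) a))

    lookup-blockAt-other : ∀ {m} {i c : Fin m} a b r → c ≢ i → lookup (blockAt i a b) (combine c r) ≡ lookup b r
    lookup-blockAt-other {m} {i} {c} a b r c≢i = trans (Vec.lookup-concat (replicate m b [ i ]≔ a) c r)
      (cong (λ v → lookup v r) (trans (Vec.lookup∘update′ c≢i (replicate m b) a) (Vec.lookup-replicate c b)))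

    combine-quotient-remainder : ∀ {m} (x : Fin (m ℕ.* l)) → combine (quotient {m} l x) (remainder {m} l x) ≡ x
    combine-quotient-remainder {m} x = Fin.combine-remQuot {m} l x

    quotient-combine : ∀ {m} (c : Fin m) (r : Fin l) → quotient {m} l (combine c r) ≡ c
    quotient-combine c r = cong proj₁ (Fin.remQuot-combine c r)

  -- The two-level cluster metric

  module _ {n m : ℕ} (cl : Fin n → Fin m) (L : ℚ) where

    -- Opaque, so that a `with` on the decisions below does not unfold it.
    opaque
      clusterDist : Fin n → Fin n → ℚ
      clusterDist x y with x Fin.≟ y | cl x Fin.≟ cl y
      ... | yes _ | _     = 0ℚ
      ... | no _  | yes _ = 1ℚ
      ... | no _  | no _  = L

      clusterDist-self : ∀ x → clusterDist x x ≡ 0ℚ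
      clusterDist-self x with x Fin.≟ x | cl x Fin.≟ cl x
      ... | yes _  | _ = refl
      ... | no x≢x | _ = ⊥-elim (x≢x refl)

      clusterDist-same : ∀ {x y} → x ≢ y → cl x ≡ cl y → clusterDist x y ≡ 1ℚ
      clusterDist-same {x} {y} x≢y same with x Fin.≟ y | cl x Fin.≟ cl y
      ... | yes x≡y | _        = ⊥-elim (x≢y x≡y)
      ... | no _    | yes _    = refl
      ... | no _    | no other = ⊥-elim (other same)

      clusterDist-other : ∀ {x y} → cl x ≢ cl y → clusterDist x y ≡ L
      clusterDist-other {x} {y} other with x Fin.≟ y | cl x Fin.≟ cl y
      ... | yes refl | _        = ⊥-elim (other refl)
      ... | no _     | yes same = ⊥-elim (other same)
      ... | no _     | no _     = refl

    clusterDist-sym : ∀ x y → clusterDist x y ≡ clusterDist y x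
    clusterDist-sym x y with x Fin.≟ y | cl x Fin.≟ cl y
    ... | yes refl | _        = refl
    ... | no x≢y   | yes same = trans (clusterDist-same x≢y same) (sym (clusterDist-same (x≢y ∘ sym) (sym same)))
    ... | no _     | no other = trans (clusterDist-other other) (sym (clusterDist-other (other ∘ sym)))

    module _ (1≤L : 1ℚ ≤ L) where

      clusterDist-sep : ∀ x y → x ≢ y → 1ℚ ≤ clusterDist x y
      clusterDist-sep x y x≢y with cl x Fin.≟ cl y
      ... | yes same = ≤-reflexive (sym (clusterDist-same x≢y same))
      ... | no other = ≤-trans 1≤L (≤-reflexive (sym (clusterDist-other other)))

      clusterDist-nonneg : ∀ x y → 0ℚ ≤ clusterDist x y
      clusterDist-nonneg x y with x Fin.≟ y
      ... | yes refl = ≤-reflexive (sym (clusterDist-self x))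
      ... | no x≢y   = ≤-trans 0≤1 (clusterDist-sep x y x≢y)

      clusterDist-≤ : ∀ x y → clusterDist x y ≤ L
      clusterDist-≤ x y with x Fin.≟ y | cl x Fin.≟ cl y
      ... | yes refl | _        = ≤-trans (≤-reflexive (clusterDist-self x)) (≤-trans 0≤1 1≤L)
      ... | no x≢y   | yes same = ≤-trans (≤-reflexive (clusterDist-same x≢y same)) 1≤L
      ... | no _     | no other = ≤-reflexive (clusterDist-other other)

      clusterDist-same-≤ : ∀ {x y} → cl x ≡ cl y → clusterDist x y ≤ 1ℚ
      clusterDist-same-≤ {x} {y} same with x Fin.≟ y
      ... | yes refl = ≤-trans (≤-reflexive (clusterDist-self x)) 0≤1
      ... | no x≢y   = ≤-reflexive (clusterDist-same x≢y same)

      clusterDist-triangle : ∀ x y z → clusterDist x z ≤ clusterDist x y + clusterDist y z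
      clusterDist-triangle x y z with x Fin.≟ z
      ... | yes refl = ≤-trans (≤-reflexive (clusterDist-self x))
                               (p≤q⇒p≤q+r _ (clusterDist-nonneg x y) (clusterDist-nonneg y x))
      ... | no x≢z with cl x Fin.≟ cl z | x Fin.≟ y | cl x Fin.≟ cl y
      ...   | yes same | yes refl | _ = ≤-trans (≤-reflexive (clusterDist-same x≢z same))
                                          (p≤q⇒p≤r+q _ (clusterDist-sep x z x≢z) (clusterDist-nonneg x x))
      ...   | yes same | no x≢y   | _ = ≤-trans (≤-reflexive (clusterDist-same x≢z same))
                                          (p≤q⇒p≤q+r _ (clusterDist-sep x y x≢y) (clusterDist-nonneg y z))
      ...   | no other | _ | yes same  = ≤-trans (≤-reflexive (clusterDist-other other))
                                          (p≤q⇒p≤r+q _ (≤-reflexive (sym (clusterDist-other (other ∘ trans same))))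
                                                     (clusterDist-nonneg x y))
      ...   | no other | _ | no other′ = ≤-trans (≤-reflexive (clusterDist-other other))
                                          (p≤q⇒p≤q+r _ (≤-reflexive (sym (clusterDist-other other′))) (clusterDist-nonneg y z))

      clusterMetric : ∀ {x₀ x₁} → x₀ ≢ x₁ → cl x₀ ≡ cl x₁ → Metric n
      clusterMetric {x₀} {x₁} x₀≢x₁ same = record
        { d        = clusterDist
        ; d-refl   = clusterDist-self
        ; d-sym    = clusterDist-sym
        ; d-tri    = clusterDist-triangle
        ; d-sep    = clusterDist-sep
        ; d-minOne = x₀ , x₁ , x₀≢x₁ , clusterDist-same x₀≢x₁ same
        }

  module _ {n : ℕ} (M : Metric n) where

    d-nonneg : ∀ x y → 0ℚ ≤ d M x y
    d-nonneg x y with x Fin.≟ y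
    ... | yes refl = ≤-reflexive (sym (d-refl M x))
    ... | no x≢y   = ≤-trans 0≤1 (d-sep M x y x≢y)

    Dist≤d : ∀ Y {x y} → lookup Y y ≡ true → Dist M Y x ≤ d M x y
    Dist≤d Y {x} y∈Y = minimumℚ-map-≤ (d M x) (members Y) (∈-members⁺ Y y∈Y)

    ≤-Dist : ∀ Y {x y c} → lookup Y y ≡ true → (∀ {y} → lookup Y y ≡ true → c ≤ d M x y) → c ≤ Dist M Y x
    ≤-Dist Y {x} y∈Y c≤d = ≤-minimumℚ-map (d M x) (members Y) (∈-members⁺ Y y∈Y) (c≤d ∘ ∈-members⁻ Y)

    Dist-nonneg : ∀ Y x → 0ℚ ≤ Dist M Y x
    Dist-nonneg Y x with members Y
    ... | []     = ≤-refl
    ... | y ∷ ys = ≤-minimumℚ-map (d M x) (y ∷ ys) (here refl) (λ _ → d-nonneg x _)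

    Cost-≤ : ∀ Y V {c} → (∀ {x} → lookup V x ≡ true → Dist M Y x ≤ c) → Cost M Y V ≤ ι ∣ V ∣ * c
    Cost-≤ Y V {c} Dist≤c = subst (λ m → Cost M Y V ≤ ι m * c) (length-members V)
      (sumℚ-map-≤ (Dist M Y) (members V) (Dist≤c ∘ ∈-members⁻ V))

    ≤-Cost : ∀ Y V {c} → (∀ {x} → lookup V x ≡ true → c ≤ Dist M Y x) → ι ∣ V ∣ * c ≤ Cost M Y V
    ≤-Cost Y V {c} c≤Dist = subst (λ m → ι m * c ≤ Cost M Y V) (length-members V)
      (≤-sumℚ-map (Dist M Y) (members V) (c≤Dist ∘ ∈-members⁻ V))

    Dist≤Cost : ∀ Y V {x} → lookup V x ≡ true → Dist M Y x ≤ Cost M Y V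
    Dist≤Cost Y V x∈V = ∈⇒≤sumℚ-map (Dist M Y) (members V) (λ _ → Dist-nonneg Y _) (∈-members⁺ V x∈V)

    Cost-≤-spike : ∀ Y V {a b} x₀ → 0ℚ ≤ a → 0ℚ ≤ b → Dist M Y x₀ ≤ a →
                   (∀ {x} → lookup V x ≡ true → x ≢ x₀ → Dist M Y x ≤ b) → Cost M Y V ≤ a + ι ∣ V ∣ * b
    Cost-≤-spike Y V {a} {b} x₀ 0≤a 0≤b Dist≤a Dist≤b = subst (λ m → Cost M Y V ≤ a + ι m * b) (length-members V)
      (sumℚ-map-≤-spike (Dist M Y) Fin._≟_ x₀ (members V) (members-unique V) 0≤a 0≤b Dist≤a (Dist≤b ∘ ∈-members⁻ V))

    OPT≤Cost : ∀ {k} Y V → ∣ Y ∣ ≡ k → OPT M k V ≤ Cost M Y V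
    OPT≤Cost {k} Y V ∣Y∣≡k =
      minimumℚ-map-≤ (λ Z → Cost M Z V) (subsetsOfSize n k) (∈-subsetsOfSize⁺ (∈-allSubsets Y) ∣Y∣≡k)

    ≤-OPT : ∀ {k c} Y V → ∣ Y ∣ ≡ k → (∀ Z → ∣ Z ∣ ≡ k → c ≤ Cost M Z V) → c ≤ OPT M k V
    ≤-OPT {k} Y V ∣Y∣≡k c≤Cost = ≤-minimumℚ-map (λ Z → Cost M Z V) (subsetsOfSize n k)
      (∈-subsetsOfSize⁺ (∈-allSubsets Y) ∣Y∣≡k) (λ {Z} → c≤Cost Z ∘ ∈-subsetsOfSize⁻)

    ratio≡Cost : ∀ {k} Y V → OPT M k V ≡ 1ℚ → ratio M k Y V ≡ Cost M Y V
    ratio≡Cost {k} Y V OPT≡1 with OPT M k V ≟ 0ℚ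
    ... | yes OPT≡0 = ⊥-elim (<-irrefl (trans (sym OPT≡0) OPT≡1) (positive⁻¹ 1ℚ))
    ... | no OPT≢0  = ÷-1 (Cost M Y V) (OPT M k V) {{ℚ.≢-nonZero OPT≢0}} OPT≡1
      where
      ÷-1 : ∀ p q .{{_ : ℚ.NonZero q}} → q ≡ 1ℚ → p ÷ q ≡ p
      ÷-1 p _ refl = *-identityʳ p

  -- Adaptive adversaries

  module _ (A : Algorithm) {n} (M : Metric n) (k : ℕ) (respond : Subset n → Subset n) where

    history : ℕ → List (Subset n)
    history zero    = []
    history (suc t) = history t ∷ʳ respond (run A M k (history t))

    adversary : ℕ → Subset n
    adversary t = respond (run A M k (history t))

    output-adversary : ∀ t → output A M k adversary t ≡ run A M k (history t)
    output-adversary t = cong (run A M k) (map-adversary-upTo t)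
      where
      map-adversary-upTo : ∀ t → map adversary (upTo t) ≡ history t
      map-adversary-upTo zero    = refl
      map-adversary-upTo (suc t) = begin
        map adversary (upTo (suc t))           ≡⟨ cong (map adversary) (List.upTo-∷ʳ t) ⟨
        map adversary (upTo t ∷ʳ t)            ≡⟨ List.map-++ adversary (upTo t) (t ∷ []) ⟩
        map adversary (upTo t) ∷ʳ adversary t  ≡⟨ cong (_∷ʳ adversary t) (map-adversary-upTo t) ⟩
        history t ∷ʳ adversary t               ∎
        where open ≡-Reasoning

  -- The hard instance

  module HardInstance (k-1 : ℕ) where

    k K n : ℕ
    k = suc k-1
    K = suc k
    n = K ℕ.* K

    point : Fin K → Fin K → Fin n
    point = combine

    clusterOf positionOf : Fin n → Fin K
    clusterOf  = quotient K
    positionOf = remainder {K} K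

    point-decomposition : ∀ x → point (clusterOf x) (positionOf x) ≡ x
    point-decomposition = combine-quotient-remainder {K}

    clusterOf-point : ∀ c r → clusterOf (point c r) ≡ c
    clusterOf-point = quotient-combine {K}

    L : ℚ
    L = ι K

    1≤L : 1ℚ ≤ L
    1≤L = ≤-trans (p≤q⇒p≤q+r (ι k) ≤-refl (0≤ι k)) (≤-reflexive (sym (ι-suc k)))

    M : Metric n
    M = clusterMetric clusterOf L 1≤L {point Fin.zero Fin.zero} {point Fin.zero (Fin.suc Fin.zero)}
          (Fin.0≢1+n ∘ Fin.combine-injectiveʳ {K} {K} Fin.zero Fin.zero Fin.zero (Fin.suc Fin.zero))
          (trans (clusterOf-point Fin.zero Fin.zero) (sym (clusterOf-point Fin.zero (Fin.suc Fin.zero))))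

    cluster clusterTail expert : Fin K → Subset n
    cluster i     = blockAt {K} i Subset.⊤ Subset.⊥
    clusterTail i = blockAt {K} i (outside Vec.∷ Subset.⊤) Subset.⊥
    expert j      = blockAt {K} j Subset.⊥ Subset.⁅ Fin.zero ⁆

    ∣cluster∣ : ∀ i → ∣ cluster i ∣ ≡ K
    ∣cluster∣ i = trans (∣blockAt-⊥∣ i Subset.⊤) (∣⊤∣≡n K)

    ∣clusterTail∣ : ∀ i → ∣ clusterTail i ∣ ≡ k
    ∣clusterTail∣ i = trans (∣blockAt-⊥∣ i (outside Vec.∷ Subset.⊤)) (∣⊤∣≡n k)

    ∣expert∣ : ∀ j → ∣ expert j ∣ ≡ k
    ∣expert∣ j = begin
      ∣ expert j ∣                                      ≡⟨ ∣blockAt∣ j Subset.⊥ Subset.⁅ Fin.zero ⁆ ⟩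
      ∣ Subset.⊥ {K} ∣ ℕ.+ k ℕ.* ∣ Subset.⁅ Fin.zero {k} ⁆ ∣
                                                        ≡⟨ cong₂ (λ a b → a ℕ.+ k ℕ.* b) (∣⊥∣≡0 K) (∣⁅x⁆∣≡1 (Fin.zero {k})) ⟩
      k ℕ.* 1                                           ≡⟨ ℕ.*-identityʳ k ⟩
      k                                                 ∎
      where open ≡-Reasoning

    point∈cluster : ∀ i r → lookup (cluster i) (point i r) ≡ true
    point∈cluster i r = trans (lookup-blockAt-same i Subset.⊤ Subset.⊥ r) (Vec.lookup-replicate r inside)

    ∈cluster⇒clusterOf : ∀ {i x} → lookup (cluster i) x ≡ true → clusterOf x ≡ i
    ∈cluster⇒clusterOf {i} {x} x∈cluster with clusterOf x Fin.≟ i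
    ... | yes same = same
    ... | no other = ⊥-elim (true≢false (begin
      true                                                     ≡⟨ x∈cluster ⟨
      lookup (cluster i) x                                     ≡⟨ cong (lookup (cluster i)) (point-decomposition x) ⟨
      lookup (cluster i) (point (clusterOf x) (positionOf x))  ≡⟨ lookup-blockAt-other Subset.⊤ Subset.⊥ (positionOf x) other ⟩
      lookup (Subset.⊥ {K}) (positionOf x)                     ≡⟨ Vec.lookup-replicate (positionOf x) outside ⟩
      false                                                    ∎))
      where open ≡-Reasoning

    ∈cluster⇒point : ∀ {i x} → lookup (cluster i) x ≡ true → point i (positionOf x) ≡ x
    ∈cluster⇒point {i} {x} x∈cluster =
      trans (cong (λ c → point c (positionOf x)) (sym (∈cluster⇒clusterOf {i} x∈cluster))) (point-decomposition x)

    ∈cluster⇒∈clusterTail : ∀ {i x} → lookup (cluster i) x ≡ true → x ≢ point i Fin.zero → lookup (clusterTail i) x ≡ true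
    ∈cluster⇒∈clusterTail {i} {x} x∈cluster x≢head = subst (λ x → lookup (clusterTail i) x ≡ true) x≡point
      (nonzero∈clusterTail (positionOf x) (λ r≡0 → x≢head (trans (sym x≡point) (cong (point i) r≡0))))
      where
      x≡point = ∈cluster⇒point {i} x∈cluster
      nonzero∈clusterTail : ∀ r → r ≢ Fin.zero → lookup (clusterTail i) (point i r) ≡ true
      nonzero∈clusterTail Fin.zero    r≢0 = ⊥-elim (r≢0 refl)
      nonzero∈clusterTail (Fin.suc r) _   =
        trans (lookup-blockAt-same i _ Subset.⊥ (Fin.suc r)) (Vec.lookup-replicate r inside)

    head∈expert : ∀ {i j} → i ≢ j → lookup (expert j) (point i Fin.zero) ≡ true
    head∈expert i≢j = lookup-blockAt-other Subset.⊥ Subset.⁅ Fin.zero ⁆ Fin.zero i≢j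

    emptyCluster : Subset n → Fin K
    emptyCluster Y with ∣ Y ∣ ℕ.<? K
    ... | yes ∣Y∣<K = proj₁ (misses-some-block {K} {K} Y ∣Y∣<K)
    ... | no _      = Fin.zero

    emptyCluster-empty : ∀ Y → ∣ Y ∣ ≡ k → ∀ r → lookup Y (point (emptyCluster Y) r) ≡ false
    emptyCluster-empty Y ∣Y∣≡k with ∣ Y ∣ ℕ.<? K
    ... | yes ∣Y∣<K = proj₂ (misses-some-block {K} {K} Y ∣Y∣<K)
    ... | no ∣Y∣≮K  = ⊥-elim (∣Y∣≮K (ℕ.≤-reflexive (cong suc ∣Y∣≡k)))

    far-from-emptyCluster : ∀ Y {x y} → ∣ Y ∣ ≡ k → lookup (cluster (emptyCluster Y)) x ≡ true → lookup Y y ≡ true →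
                            d M x y ≡ L
    far-from-emptyCluster Y {x} {y} ∣Y∣≡k x∈cluster y∈Y = clusterDist-other clusterOf L λ same → true≢false (begin
      true                                              ≡⟨ y∈Y ⟨
      lookup Y y                                        ≡⟨ cong (lookup Y) (point-decomposition y) ⟨
      lookup Y (point (clusterOf y) (positionOf y))     ≡⟨ cong (λ c → lookup Y (point c (positionOf y)))
                                                             (trans (sym same) (∈cluster⇒clusterOf {emptyCluster Y} x∈cluster)) ⟩
      lookup Y (point (emptyCluster Y) (positionOf y))  ≡⟨ emptyCluster-empty Y ∣Y∣≡k (positionOf y) ⟩
      false                                             ∎)
      where open ≡-Reasoning

    K*L≤Cost-emptyCluster : ∀ Y → ∣ Y ∣ ≡ k → ι K * L ≤ Cost M Y (cluster (emptyCluster Y))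
    K*L≤Cost-emptyCluster Y ∣Y∣≡k = subst (λ m → ι m * L ≤ Cost M Y (cluster (emptyCluster Y))) (∣cluster∣ (emptyCluster Y))
      (≤-Cost M Y (cluster (emptyCluster Y)) λ x∈cluster →
        ≤-Dist M Y (proj₂ (nonempty Y ∣Y∣≡k)) λ y∈Y → ≤-reflexive (sym (far-from-emptyCluster Y ∣Y∣≡k x∈cluster y∈Y)))

    Cost-clusterTail≤1 : ∀ i → Cost M (clusterTail i) (cluster i) ≤ 1ℚ
    Cost-clusterTail≤1 i =
      ≤-trans (Cost-≤-spike M (clusterTail i) (cluster i) (point i Fin.zero) 0≤1 ≤-refl Dist-head Dist-tail)
              (≤-reflexive (trans (cong (1ℚ +_) (*-zeroʳ (ι ∣ cluster i ∣))) (+-identityʳ 1ℚ)))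
      where
      Dist-head : Dist M (clusterTail i) (point i Fin.zero) ≤ 1ℚ
      Dist-head = ≤-trans (Dist≤d M (clusterTail i) (lookup-blockAt-same i _ Subset.⊥ (Fin.suc Fin.zero)))
        (clusterDist-same-≤ clusterOf L 1≤L (trans (clusterOf-point i Fin.zero) (sym (clusterOf-point i (Fin.suc Fin.zero)))))
      Dist-tail : ∀ {x} → lookup (cluster i) x ≡ true → x ≢ point i Fin.zero → Dist M (clusterTail i) x ≤ 0ℚ
      Dist-tail {x} x∈cluster x≢head = ≤-trans (Dist≤d M (clusterTail i) (∈cluster⇒∈clusterTail {i} x∈cluster x≢head))
                                               (≤-reflexive (clusterDist-self clusterOf L x))

    1≤Cost-cluster : ∀ i Z → ∣ Z ∣ ≡ k → 1ℚ ≤ Cost M Z (cluster i)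
    1≤Cost-cluster i Z ∣Z∣≡k =
      let r , point∉Z = misses-point-of-every-block {K} {K} Z (ℕ.≤-reflexive (cong suc ∣Z∣≡k)) i
          apart : ∀ {y} → lookup Z y ≡ true → point i r ≢ y
          apart y∈Z point≡y = true≢false (trans (sym y∈Z) (subst (λ y → lookup Z y ≡ false) point≡y point∉Z))
      in ≤-trans (≤-Dist M Z (proj₂ (nonempty Z ∣Z∣≡k)) λ {y} y∈Z → clusterDist-sep clusterOf L 1≤L _ y (apart y∈Z))
                 (Dist≤Cost M Z (cluster i) (point∈cluster i r))

    OPT-cluster≡1 : ∀ i → OPT M k (cluster i) ≡ 1ℚ
    OPT-cluster≡1 i = ≤-antisym (≤-trans (OPT≤Cost M (clusterTail i) (cluster i) (∣clusterTail∣ i)) (Cost-clusterTail≤1 i))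
                                (≤-OPT M (clusterTail i) (cluster i) (∣clusterTail∣ i) (1≤Cost-cluster i))

    ratio-cluster : ∀ Y i → ratio M k Y (cluster i) ≡ Cost M Y (cluster i)
    ratio-cluster Y i = ratio≡Cost M Y (cluster i) (OPT-cluster≡1 i)

    Cost-expert≤K*L : ∀ j i → Cost M (expert j) (cluster i) ≤ ι K * L
    Cost-expert≤K*L j i = subst (λ m → Cost M (expert j) (cluster i) ≤ ι m * L) (∣cluster∣ i)
      (Cost-≤ M (expert j) (cluster i) λ _ →
        ≤-trans (Dist≤d M (expert j) (proj₂ (nonempty (expert j) (∣expert∣ j)))) (clusterDist-≤ clusterOf L 1≤L _ _))

    Cost-expert≤K : ∀ {j i} → i ≢ j → Cost M (expert j) (cluster i) ≤ ι K * 1ℚ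
    Cost-expert≤K {j} {i} i≢j = subst (λ m → Cost M (expert j) (cluster i) ≤ ι m * 1ℚ) (∣cluster∣ i)
      (Cost-≤ M (expert j) (cluster i) λ x∈cluster → ≤-trans (Dist≤d M (expert j) (head∈expert i≢j))
        (clusterDist-same-≤ clusterOf L 1≤L (trans (∈cluster⇒clusterOf {i} x∈cluster) (sym (clusterOf-point i Fin.zero)))))

    sum-ratio-experts : ∀ i → sumℚ (map (λ j → ratio M k (expert j) (cluster i)) (allFin K)) ≤ ι K * (L + ι K)
    sum-ratio-experts i = begin
      sumℚ (map (λ j → ratio M k (expert j) (cluster i)) (allFin K))
        ≤⟨ sumℚ-map-≤-spike (λ j → ratio M k (expert j) (cluster i)) Fin._≟_ i (allFin K) (Unique.allFin⁺ K)
             (*-nonneg (0≤ι K) (0≤ι K)) (*-nonneg (0≤ι K) 0≤1)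
             (≤-trans (≤-reflexive (ratio-cluster (expert i) i)) (Cost-expert≤K*L i i))
             (λ {j} _ j≢i → ≤-trans (≤-reflexive (ratio-cluster (expert j) i)) (Cost-expert≤K (j≢i ∘ sym))) ⟩
      ι K * L + ι (length (allFin K)) * (ι K * 1ℚ)
        ≡⟨ cong (λ m → ι K * L + ι m * (ι K * 1ℚ)) (List.length-tabulate {n = K} (λ j → j)) ⟩
      ι K * L + ι K * (ι K * 1ℚ)
        ≡⟨ solve 2 (λ κ l → κ :* l :+ κ :* (κ :* con 1ℚ) := κ :* (l :+ κ)) refl (ι K) L ⟩
      ι K * (L + ι K) ∎
      where open ≤-Reasoning

    module Play (A : Algorithm) where

      V : ℕ → Subset n
      V = adversary A M k (cluster ∘ emptyCluster)

      played : ℕ → Subset n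
      played t = run A M k (history A M k (cluster ∘ emptyCluster) t)

      k<∣V∣ : ∀ t → suc k ℕ.≤ ∣ V t ∣
      k<∣V∣ t = ℕ.≤-reflexive (sym (∣cluster∣ (emptyCluster (played t))))

      K*L≤ratio-played : ∀ t → ι K * L ≤ ratio M k (output A M k V t) (V t)
      K*L≤ratio-played t = subst (λ Y → ι K * L ≤ ratio M k Y (V t)) (sym (output-adversary A M k _ t))
        (≤-trans (K*L≤Cost-emptyCluster (played t) (valid A M k _ k≤n))
                 (≤-reflexive (sym (ratio-cluster (played t) (emptyCluster (played t))))))
        where
        k≤n : k ℕ.≤ n
        k≤n = ℕ.≤-trans (ℕ.n≤1+n k) (ℕ.m≤m+n K (k ℕ.* K))

      sum-ratio-played : ∀ T → ι T * (ι K * L) ≤ sumFrom1 T (λ t → ratio M k (output A M k V t) (V t))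
      sum-ratio-played T = subst (λ m → ι m * (ι K * L) ≤ sumFrom1 T (λ t → ratio M k (output A M k V t) (V t)))
        (List.length-upTo T)
        (≤-sumℚ-map (λ t → ratio M k (output A M k V (suc t)) (V (suc t))) (upTo T) (λ _ → K*L≤ratio-played _))

      best-expert : ∀ T → ∃ λ j → sumFrom1 T (λ t → ratio M k (expert j) (V t)) ≤ ι T * (L + ι K)
      best-expert T =
        let j , K*Sj≤ΣS = ∃-length*≤sumℚ-map S Fin.zero (tabulate Fin.suc)
        in j , *-cancelˡ-≤-pos (ι K) {{ℚ.positive (0<ι-suc k)}} (begin
          ι K * S j                                ≡⟨ cong (λ m → ι m * S j) (List.length-tabulate {n = K} (λ j → j)) ⟨
          ι (length (allFin K)) * S j              ≤⟨ K*Sj≤ΣS ⟩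
          sumℚ (map S (allFin K))                  ≡⟨ sumℚ-map-comm (λ j t → ratio M k (expert j) (V (suc t))) (allFin K) (upTo T) ⟩
          sumℚ (map (λ t → sumℚ (map (λ j → ratio M k (expert j) (V (suc t))) (allFin K))) (upTo T))
                                                   ≤⟨ sumℚ-map-≤ _ (upTo T) (λ {t} _ → sum-ratio-experts (emptyCluster (played (suc t)))) ⟩
          ι (length (upTo T)) * (ι K * (L + ι K))  ≡⟨ cong (λ m → ι m * (ι K * (L + ι K))) (List.length-upTo T) ⟩
          ι T * (ι K * (L + ι K))                  ≡⟨ solve 3 (λ τ κ b → τ :* (κ :* b) := κ :* (τ :* b)) refl (ι T) (ι K) (L + ι K) ⟩
          ι K * (ι T * (L + ι K))                  ∎)
        where
        open ≤-Reasoning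
        S : Fin K → ℚ
        S j = sumFrom1 T (λ t → ratio M k (expert j) (V t))

      no-regret-bound : ∀ {a G} T-1 → 0ℚ ≤ a → a ≤ ½ * ι k → G ≤ ι (suc T-1) →
        ¬ (∀ Y → ∣ Y ∣ ≡ k → sumFrom1 (suc T-1) (λ t → ratio M k (output A M k V t) (V t))
                              ≤ a * sumFrom1 (suc T-1) (λ t → ratio M k Y (V t)) + G)
      no-regret-bound {a} {G} T-1 0≤a a≤k/2 G≤T regret-bound =
        let j , Sj≤ = best-expert T
        in <-irrefl refl (begin-strict
          ι T * (ι K * ι K)                                       ≤⟨ sum-ratio-played T ⟩
          sumFrom1 T (λ t → ratio M k (output A M k V t) (V t))  ≤⟨ regret-bound (expert j) (∣expert∣ j) ⟩
          a * sumFrom1 T (λ t → ratio M k (expert j) (V t)) + G  <⟨ regret-gap (ι-suc k) (0<ι-suc T-1) (0<ι-suc k-1) 0≤a a≤k/2 Sj≤ G≤T ⟩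
          ι T * (ι K * ι K)                                       ∎)
        where
        open ≤-Reasoning
        T = suc T-1

      no-sublinear-regret : ∀ {a g} (f : ℕ → ℕ → ℚ → ℚ) → 0ℚ ≤ a → a ≤ ½ * ι k → (∀ T → 0ℚ ≤ g T) → Sublinear g →
        ¬ (∀ T (Y : Subset n) → ∣ Y ∣ ≡ k → sumFrom1 T (λ t → ratio M k (output A M k V t) (V t))
                                             ≤ a * sumFrom1 T (λ t → ratio M k Y (V t)) + g T * f k n (aspect M))
      no-sublinear-regret f 0≤a a≤k/2 0≤g g-sublinear regret-bound =
        let T-1 , gF≤T = sublinear-absorbs 0≤g g-sublinear (f k n (aspect M))
        in no-regret-bound T-1 0≤a a≤k/2 gF≤T (regret-bound (suc T-1))

open LowerBound using (module HardInstance; sublinear-≤-half)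
open import Data.Nat using (ℕ; suc; _≤_; s≤s; z≤n)
open import Data.Fin.Subset using (Subset; ∣_∣)
open import Data.Rational using (ℚ; 0ℚ; _+_; _*_)
import Data.Rational
open import Data.Product using (Σ; _×_; _,_)
open import Relation.Binary.PropositionalEquality using (_≡_)
open import Relation.Nullary using (¬_)

theorem5 : ¬ (Σ Algorithm λ A → Σ (ℕ → ℚ) λ α → Σ (ℕ → ℚ) λ g → Σ (ℕ → ℕ → ℚ → ℚ) λ f →
               (∀ k → 0ℚ Data.Rational.≤ α k) × Sublinear α ×
               (∀ T → 0ℚ Data.Rational.≤ g T) × Sublinear g ×
               (∀ (k : ℕ) → 1 ≤ k → ∀ (n : ℕ) (M : Metric n) (T : ℕ) (V : ℕ → Subset n) →
                  (∀ t → t ≤ T → suc k ≤ ∣ V t ∣) →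
                  (Y : Subset n) → ∣ Y ∣ ≡ k →
                  sumFrom1 T (λ t → ratio M k (output A M k V t) (V t))
                    Data.Rational.≤ (α k * sumFrom1 T (λ t → ratio M k Y (V t)) + g T * f k n (aspect M))))
theorem5 (A , α , g , f , 0≤α , α-sublinear , 0≤g , g-sublinear , regret-bound)
  with sublinear-≤-half α-sublinear
... | N , αk≤k/2 = no-sublinear-regret f (0≤α k) αk≤k/2 0≤g g-sublinear
                     (λ T → regret-bound k (s≤s z≤n) n M T V (λ t _ → k<∣V∣ t))
  where
  open HardInstance N
  open Play A
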